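{- Let $x\geq 2$ be an even integer and let $rL$ be a linear realization of a list $L$ which is of type $\mathcal{C}_x$. Then: (1) $\vartheta_x(rL):=\mu_{x-1}(\eta_{x-1}(rL))$ is (defined and is) a linear realization of $L\cup\{x,x\}$ of type $\mathcal{C}_x$; (2) $\sigma_x(rL):=\mu_x(\eta_{x-1}(rL))$ is (defined and is) a linear realization of $L\cup\{x-1,x+1\}$ of type $\mathcal{C}_x$.
   Context: For a list (multiset) $L$ of positive integers with $|L|$ elements, a linear realization $rL$ of $L$ is an ordering $[x_0,\ldots,x_{|L|}]$ of $\{0,1,\ldots,|L|\}$ such that the multiset $\{|x_i-x_{i+1}|:0\le i\le |L|-1\}$ equals $L$; two vertices are adjacent in $rL$ if they appear consecutively. For a positive integer $y$: $rL$ is of type $\mathcal{A}_y$ if the vertices $|L|-y$ and $|L|-y+1$ are adjacent in $rL$; it is of type $\mathcal{B}_y$ if the vertices $|L|-y$ and $|L|$ are adjacent in $rL$. For $rL$ of type $\mathcal{A}_y$, $\eta_y(rL)$ is the sequence obtained by inserting the new vertex $|L|+1$ between the adjacent vertices $|L|-y$ and $|L|-y+1$; for $rL$ of type $\mathcal{B}_y$, $\mu_y(rL)$ is the sequence obtained by inserting $|L|+1$ between the adjacent vertices $|L|-y$ and $|L|$. For even $x$, $rL$ is of type $\mathcal{C}_x$ if the vertices $|L|-(2i+1)$ and $|L|-2i$ are adjacent in $rL$ for all $i=0,\ldots,\frac{x-2}{2}$. Here $L\cup\{\cdot\}$ denotes multiset union. -}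

module Defs where

open import Data.Nat using (ℕ; zero; suc; _+_; _*_; _∸_; _≤_; ∣_-_∣; _≟_)
open import Data.List using (List; []; _∷_; length; upTo)
open import Data.Product using (_×_; _,_)
open import Data.Sum using (_⊎_)
open import Data.Bool using (Bool; true; false; _∧_; _∨_)
open import Relation.Nullary.Decidable using (⌊_⌋)
open import Relation.Binary.PropositionalEquality using (_≡_)
open import Data.List.Relation.Binary.Permutation.Propositional using (_↭_)

diffs : List ℕ → List ℕ
diffs (a ∷ b ∷ s) = ∣ a - b ∣ ∷ diffs (b ∷ s)
diffs _ = []

LinReal : List ℕ → List ℕ → Set
LinReal L s = (s ↭ upTo (suc (length L))) × (diffs s ↭ L)

data Adj (a b : ℕ) : List ℕ → Set where
  here  : ∀ {u v s} → ((u ≡ a × v ≡ b) ⊎ (u ≡ b × v ≡ a)) → Adj a b (u ∷ v ∷ s)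
  there : ∀ {u s} → Adj a b s → Adj a b (u ∷ s)

ins : ℕ → ℕ → ℕ → ℕ → List ℕ → List ℕ
ins a b v u [] = u ∷ []
ins a b v u (w ∷ s) with (⌊ u ≟ a ⌋ ∧ ⌊ w ≟ b ⌋) ∨ (⌊ u ≟ b ⌋ ∧ ⌊ w ≟ a ⌋)
... | true  = u ∷ v ∷ w ∷ s
... | false = u ∷ ins a b v w s

insertBetween : ℕ → ℕ → ℕ → List ℕ → List ℕ
insertBetween a b v [] = []
insertBetween a b v (u ∷ s) = ins a b v u s

-- Below, n plays the role of |L| (the realization s has n+1 vertices).
-- Type A_y: vertices n-y and n-y+1 adjacent (vertex n-y must exist).
TypeA : ℕ → ℕ → List ℕ → Set
TypeA n y s = (y ≤ n) × Adj (n ∸ y) (n ∸ y + 1) s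

TypeB : ℕ → ℕ → List ℕ → Set
TypeB n y s = (y ≤ n) × Adj (n ∸ y) n s

TypeC : ℕ → ℕ → List ℕ → Set
TypeC n x s = ∀ i → 2 * i + 2 ≤ x → (2 * i + 1 ≤ n) × Adj (n ∸ (2 * i + 1)) (n ∸ (2 * i)) s

eta : ℕ → ℕ → List ℕ → List ℕ
eta n y s = insertBetween (n ∸ y) (n ∸ y + 1) (suc n) s

mu : ℕ → ℕ → List ℕ → List ℕ
mu n y s = insertBetween (n ∸ y) n (suc n) s

module Submission where

-- Write n = |L| and x = k + 2 with k even.  The last pair of type C_x says
-- that n-(k+1) and n-k are adjacent in rL, i.e. rL has type A_{x-1}, so
-- η_{x-1} inserts n+1 between them.  Afterwards n+1 is adjacent to both
-- n-(k+1) and n-k, hence μ_{x-1} (gap {n-k, n+1}) and μ_x (gap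
-- {n-(k+1), n+1}) are defined.
--
-- Everything rests on one general fact about inserting a vertex v into a
-- gap {a, b} of a sequence (`insertion`): the vertex multiset gains v, the
-- difference multiset trades |a-b| for |a-v| and |b-v|, v becomes adjacent
-- to a and b, and every adjacency whose first vertex avoids a and b
-- survives.  The six distances involved are computed by `dist-below`;
-- cancelling in the difference multisets gives L ∪ {x,x} and
-- L ∪ {x-1,x+1}.  For type C_x, the pairs of C_{x-2} lie strictly above
-- n-k, away from every gap used, so they survive (`typeC-keep`); together
-- with the new adjacency {n+1, n+2} they form type C_x of the enlarged
-- realization (`typeC-extend`).

open import Defs
open import Data.Nat using (ℕ; zero; suc; _+_; _*_; _∸_; _≤_; _<_; ∣_-_∣; _≟_; z≤n; s≤s; s≤s⁻¹)
open import Data.Nat.Properties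
  using ( ≤-refl; ≤-trans; ≤-reflexive; ≤-<-trans; <-irrefl; n<1+n; n≤1+n; m≤n⇒m≤1+n
        ; ∸-monoʳ-≤; ∸-monoʳ-<; m∸n≤m; m∸n+n≡m; +-∸-comm; ∣m-m+n∣≡n; ∣-∣-comm
        ; +-comm; +-assoc; +-suc; *-suc; *-comm )
open import Data.Nat.Divisibility using (_∣_; divides)
open import Data.Bool using (T; true; false; _∧_; _∨_)
open import Data.Bool.Properties using (T-∧; T-∨)
open import Data.List using (List; []; _∷_; length; upTo)
open import Data.List.Properties using (upTo-∷ʳ)
open import Data.List.Relation.Binary.Permutation.Propositional
  using (_↭_; ↭-refl; ↭-prep; ↭-swap; ↭-trans; ↭-reflexive; module PermutationReasoning)
open import Data.List.Relation.Binary.Permutation.Propositional.Properties using (shift; drop-∷; ∷↭∷ʳ)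
open import Data.Product using (∃; _×_; _,_; proj₁; proj₂)
open import Data.Sum using (_⊎_; inj₁; inj₂)
open import Data.Unit using (tt)
open import Data.Empty using (⊥-elim)
open import Function.Bundles using (Equivalence)
open import Relation.Nullary using (¬_; Dec)
open import Relation.Nullary.Decidable using (⌊_⌋; toWitness; fromWitness)
open import Relation.Binary.PropositionalEquality
  using (_≡_; _≢_; refl; sym; trans; cong; subst; module ≡-Reasoning)

open Equivalence using (to; from)

Gap : ℕ → ℕ → ℕ → ℕ → Set
Gap a b u w = (u ≡ a × w ≡ b) ⊎ (u ≡ b × w ≡ a)

-- The test performed by `ins` is exactly the decision of `Gap`: it is the
-- Boolean shadow of the decision procedure for (A × B) ⊎ (C × D).
module _ {A B C D : Set} (a? : Dec A) (b? : Dec B) (c? : Dec C) (d? : Dec D) where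

  either-sound : T ((⌊ a? ⌋ ∧ ⌊ b? ⌋) ∨ (⌊ c? ⌋ ∧ ⌊ d? ⌋)) → (A × B) ⊎ (C × D)
  either-sound t with to (T-∨ {⌊ a? ⌋ ∧ ⌊ b? ⌋}) t
  ... | inj₁ ab = let (ta , tb) = to (T-∧ {⌊ a? ⌋}) ab in inj₁ (toWitness ta , toWitness tb)
  ... | inj₂ cd = let (tc , td) = to (T-∧ {⌊ c? ⌋}) cd in inj₂ (toWitness tc , toWitness td)

  either-complete : (A × B) ⊎ (C × D) → T ((⌊ a? ⌋ ∧ ⌊ b? ⌋) ∨ (⌊ c? ⌋ ∧ ⌊ d? ⌋))
  either-complete (inj₁ (a , b)) = from (T-∨ {⌊ a? ⌋ ∧ ⌊ b? ⌋}) (inj₁ (from (T-∧ {⌊ a? ⌋}) (fromWitness a , fromWitness b)))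
  either-complete (inj₂ (c , d)) = from (T-∨ {⌊ a? ⌋ ∧ ⌊ b? ⌋}) (inj₂ (from (T-∧ {⌊ c? ⌋}) (fromWitness c , fromWitness d)))

skip-gap : ∀ {a b u w s} → Adj a b (u ∷ w ∷ s) → ¬ Gap a b u w → Adj a b (w ∷ s)
skip-gap (here g)  ¬g = ⊥-elim (¬g g)
skip-gap (there h) _  = h

ins-head : ∀ a b v u s → ∃ λ r → ins a b v u s ≡ u ∷ r
ins-head a b v u [] = _ , refl
ins-head a b v u (w ∷ s) with (⌊ u ≟ a ⌋ ∧ ⌊ w ≟ b ⌋) ∨ (⌊ u ≟ b ⌋ ∧ ⌊ w ≟ a ⌋)
... | true  = _ , refl
... | false = _ , refl

record Insertion (a b v : ℕ) (s t : List ℕ) : Set where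
  field
    vertices    : t ↭ v ∷ s
    differences : ∣ a - b ∣ ∷ diffs t ↭ ∣ a - v ∣ ∷ ∣ b - v ∣ ∷ diffs s
    adjˡ        : Adj a v t
    adjʳ        : Adj b v t
    keep        : ∀ {c d} → Adj c d s → c ≢ a → c ≢ b → Adj c d t

insertion-front : ∀ a b v s → Insertion a b v (a ∷ b ∷ s) (a ∷ v ∷ b ∷ s)
insertion-front a b v s = record
  { vertices    = ↭-swap a v ↭-refl
  ; differences = begin
      ∣ a - b ∣ ∷ ∣ a - v ∣ ∷ ∣ v - b ∣ ∷ diffs (b ∷ s)
        ≡⟨ cong (λ d → ∣ a - b ∣ ∷ ∣ a - v ∣ ∷ d ∷ diffs (b ∷ s)) (∣-∣-comm v b) ⟩
      ∣ a - b ∣ ∷ ∣ a - v ∣ ∷ ∣ b - v ∣ ∷ diffs (b ∷ s)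
        ↭⟨ shift ∣ a - b ∣ (∣ a - v ∣ ∷ ∣ b - v ∣ ∷ []) (diffs (b ∷ s)) ⟨
      ∣ a - v ∣ ∷ ∣ b - v ∣ ∷ ∣ a - b ∣ ∷ diffs (b ∷ s) ∎
  ; adjˡ        = here (inj₁ (refl , refl))
  ; adjʳ        = there (here (inj₂ (refl , refl)))
  ; keep        = kept
  }
  where
  open PermutationReasoning
  kept : ∀ {c d} → Adj c d (a ∷ b ∷ s) → c ≢ a → c ≢ b → Adj c d (a ∷ v ∷ b ∷ s)
  kept (here (inj₁ (refl , _))) c≢a _   = ⊥-elim (c≢a refl)
  kept (here (inj₂ (_ , refl))) _   c≢b = ⊥-elim (c≢b refl)
  kept (there h)                _   _   = there (there h)

insertion-sym : ∀ {a b v s t} → Insertion b a v s t → Insertion a b v s t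
insertion-sym {a} {b} {v} {s} {t} I = record
  { vertices    = vertices
  ; differences = begin
      ∣ a - b ∣ ∷ diffs t ≡⟨ cong (_∷ diffs t) (∣-∣-comm a b) ⟩
      ∣ b - a ∣ ∷ diffs t ↭⟨ differences ⟩
      ∣ b - v ∣ ∷ ∣ a - v ∣ ∷ diffs s ↭⟨ ↭-swap _ _ ↭-refl ⟩
      ∣ a - v ∣ ∷ ∣ b - v ∣ ∷ diffs s ∎
  ; adjˡ        = adjʳ
  ; adjʳ        = adjˡ
  ; keep        = λ h c≢a c≢b → keep h c≢b c≢a
  }
  where
  open Insertion I
  open PermutationReasoning

insertion-cons : ∀ u {a b v w s r} → Insertion a b v (w ∷ s) (w ∷ r) → Insertion a b v (u ∷ w ∷ s) (u ∷ w ∷ r)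
insertion-cons u {a} {b} {v} {w} {s} {r} I = record
  { vertices    = ↭-trans (↭-prep u vertices) (↭-swap u v ↭-refl)
  ; differences = begin
      ∣ a - b ∣ ∷ ∣ u - w ∣ ∷ diffs (w ∷ r)               ↭⟨ ↭-swap _ _ ↭-refl ⟩
      ∣ u - w ∣ ∷ ∣ a - b ∣ ∷ diffs (w ∷ r)               ↭⟨ ↭-prep _ differences ⟩
      ∣ u - w ∣ ∷ ∣ a - v ∣ ∷ ∣ b - v ∣ ∷ diffs (w ∷ s)
        ↭⟨ shift ∣ u - w ∣ (∣ a - v ∣ ∷ ∣ b - v ∣ ∷ []) (diffs (w ∷ s)) ⟨
      ∣ a - v ∣ ∷ ∣ b - v ∣ ∷ ∣ u - w ∣ ∷ diffs (w ∷ s) ∎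
  ; adjˡ        = there adjˡ
  ; adjʳ        = there adjʳ
  ; keep        = kept
  }
  where
  open Insertion I
  open PermutationReasoning
  kept : ∀ {c d} → Adj c d (u ∷ w ∷ s) → c ≢ a → c ≢ b → Adj c d (u ∷ w ∷ r)
  kept (here g)  _   _   = here g
  kept (there h) c≢a c≢b = there (keep h c≢a c≢b)

insertion-ins : ∀ a b v u s → Adj a b (u ∷ s) → Insertion a b v (u ∷ s) (ins a b v u s)
insertion-ins a b v u []      (there ())
insertion-ins a b v u (w ∷ s) adj
  with (⌊ u ≟ a ⌋ ∧ ⌊ w ≟ b ⌋) ∨ (⌊ u ≟ b ⌋ ∧ ⌊ w ≟ a ⌋)
     | either-sound (u ≟ a) (w ≟ b) (u ≟ b) (w ≟ a)
     | either-complete (u ≟ a) (w ≟ b) (u ≟ b) (w ≟ a)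
... | true  | sound | _ with sound tt
...   | inj₁ (refl , refl) = insertion-front a b v s
...   | inj₂ (refl , refl) = insertion-sym (insertion-front b a v s)
insertion-ins a b v u (w ∷ s) adj | false | _ | complete
  with ins a b v w s | ins-head a b v w s | insertion-ins a b v w s (skip-gap adj complete)
... | .(w ∷ r) | r , refl | I = insertion-cons u I

insertion : ∀ {a b v s} → Adj a b s → Insertion a b v s (insertBetween a b v s)
insertion {s = u ∷ s} adj = insertion-ins _ _ _ u s adj

insertion-distances : ∀ {a b v s t p q r} → Insertion a b v s t →
  ∣ a - b ∣ ≡ p → ∣ a - v ∣ ≡ q → ∣ b - v ∣ ≡ r → p ∷ diffs t ↭ q ∷ r ∷ diffs s
insertion-distances I refl refl refl = Insertion.differences I

vertices-extend : ∀ {n s t} → t ↭ n ∷ s → s ↭ upTo n → t ↭ upTo (suc n)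
vertices-extend {n} t↭ s↭ =
  ↭-trans t↭ (↭-trans (↭-prep n s↭) (↭-trans (∷↭∷ʳ n (upTo n)) (↭-reflexive (upTo-∷ʳ n))))

dist-below : ∀ {m n} d → m ≤ n → ∣ n ∸ m - d + n ∣ ≡ d + m
dist-below {m} {n} d m≤n = begin
  ∣ n ∸ m - d + n ∣               ≡⟨ cong (λ z → ∣ n ∸ m - z ∣) split ⟩
  ∣ n ∸ m - n ∸ m + (d + m) ∣     ≡⟨ ∣m-m+n∣≡n (n ∸ m) (d + m) ⟩
  d + m                           ∎
  where
  open ≡-Reasoning
  split : d + n ≡ n ∸ m + (d + m)
  split = begin
    d + n             ≡⟨ cong (d +_) (sym (m∸n+n≡m m≤n)) ⟩
    d + (n ∸ m + m)   ≡⟨ sym (+-assoc d (n ∸ m) m) ⟩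
    d + (n ∸ m) + m   ≡⟨ cong (_+ m) (+-comm d (n ∸ m)) ⟩
    n ∸ m + d + m     ≡⟨ +-assoc (n ∸ m) d m ⟩
    n ∸ m + (d + m)   ∎

∣n-1+n∣≡1 : ∀ n → ∣ n - suc n ∣ ≡ 1
∣n-1+n∣≡1 n = dist-below 1 (z≤n {n})

∸-suc-+1 : ∀ {k n} → suc k ≤ n → n ∸ suc k + 1 ≡ n ∸ k
∸-suc-+1 {k} {n} le = trans (sym (+-∸-comm 1 le)) (cong (_∸ suc k) (+-comm n 1))

-- The vertex a is not among those paired by type C_k, which all lie in
-- the interval (n-k, n].
Outside : ℕ → ℕ → ℕ → Set
Outside n k a = a ≤ n ∸ k ⊎ n < a

typeC-keep : ∀ {n k a b v s t} → k ≤ n → Outside n k a → Outside n k b →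
  Insertion a b v s t → TypeC n k s → TypeC n k t
typeC-keep {n} {k} k≤n out-a out-b I C i le =
  proj₁ (C i le) , Insertion.keep I (proj₂ (C i le)) (avoids out-a) (avoids out-b)
  where
  above : n ∸ k < n ∸ (2 * i + 1)
  above = ∸-monoʳ-< (subst (_≤ k) (+-suc (2 * i) 1) le) k≤n
  avoids : ∀ {a} → Outside n k a → n ∸ (2 * i + 1) ≢ a
  avoids (inj₁ a≤) refl = <-irrefl refl (≤-<-trans a≤ above)
  avoids (inj₂ n<a) refl = <-irrefl refl (≤-<-trans (m∸n≤m n (2 * i + 1)) n<a)

typeC-weaken : ∀ {n k s} → TypeC n (2 + k) s → TypeC n k s
typeC-weaken C i le = C i (≤-trans le (m≤n⇒m≤1+n (m≤n⇒m≤1+n ≤-refl)))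

typeC-last : ∀ {n s} i → TypeC n (2 + 2 * i) s → TypeA n (suc (2 * i)) s
typeC-last {n} {s} i C = bound , subst (λ m → Adj (n ∸ suc (2 * i)) m s) (sym (∸-suc-+1 bound)) adj
  where
  last-pair : (suc (2 * i) ≤ n) × Adj (n ∸ suc (2 * i)) (n ∸ 2 * i) s
  last-pair = subst (λ m → (m ≤ n) × Adj (n ∸ m) (n ∸ 2 * i) s) (+-comm (2 * i) 1)
                    (C i (≤-reflexive (+-comm (2 * i) 2)))
  bound : suc (2 * i) ≤ n
  bound = proj₁ last-pair
  adj : Adj (n ∸ suc (2 * i)) (n ∸ 2 * i) s
  adj = proj₂ last-pair

typeC-extend : ∀ {n k t} → TypeC n k t → Adj (suc n) (suc (suc n)) t → TypeC (suc (suc n)) (2 + k) t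
typeC-extend C top zero    _  = s≤s z≤n , top
typeC-extend {n} {k} {t} C top (suc j) le =
  subst (λ m → (m + 1 ≤ 2 + n) × Adj (2 + n ∸ (m + 1)) (2 + n ∸ m) t) (sym (*-suc 2 j))
        (s≤s (s≤s (proj₁ old)) , proj₂ old)
  where
  old : (2 * j + 1 ≤ n) × Adj (n ∸ (2 * j + 1)) (n ∸ 2 * j) t
  old = C j (s≤s⁻¹ (s≤s⁻¹ (subst (λ m → m + 2 ≤ 2 + k) (*-suc 2 j) le)))

module TwoInsertions {L s : List ℕ} {k : ℕ}
         (real : LinReal L s) (C : TypeC (length L) k s) (A : TypeA (length L) (suc k) s) where

  n : ℕ
  n = length L

  k<n : suc k ≤ n
  k<n = proj₁ A

  k≤n : k ≤ n
  k≤n = ≤-trans (n≤1+n k) k<n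

  t₁ : List ℕ
  t₁ = eta n (suc k) s

  η : Insertion (n ∸ suc k) (n ∸ suc k + 1) (suc n) s t₁
  η = insertion (proj₂ A)

  η-diffs : 1 ∷ diffs t₁ ↭ (2 + k) ∷ (1 + k) ∷ diffs s
  η-diffs = insertion-distances η (∣m-m+n∣≡n (n ∸ suc k) 1) (dist-below 1 k<n)
              (trans (cong (λ z → ∣ z - suc n ∣) (∸-suc-+1 k<n)) (dist-below 1 k≤n))

  C₁ : TypeC n k t₁
  C₁ = typeC-keep k≤n (inj₁ (∸-monoʳ-≤ n (n≤1+n k))) (inj₁ (≤-reflexive (∸-suc-+1 k<n))) η C

  typeB-ϑ : TypeB (suc n) (suc k) t₁
  typeB-ϑ = m≤n⇒m≤1+n k<n , subst (λ z → Adj z (suc n) t₁) (∸-suc-+1 k<n) (Insertion.adjʳ η)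

  typeB-σ : TypeB (suc n) (2 + k) t₁
  typeB-σ = s≤s k<n , Insertion.adjˡ η

  second : ∀ {a t} → Outside n k a → Insertion a (suc n) (2 + n) t₁ t →
           (t ↭ upTo (3 + n)) × TypeC (2 + n) (2 + k) t
  second out I =
    vertices-extend (Insertion.vertices I) (vertices-extend (Insertion.vertices η) (proj₁ real)) ,
    typeC-extend (typeC-keep k≤n out (inj₂ (n<1+n n)) I C₁) (Insertion.adjʳ I)

  open PermutationReasoning

  ϑ : let t₂ = mu (suc n) (suc k) t₁ in
      TypeB (suc n) (suc k) t₁ × LinReal ((2 + k) ∷ (2 + k) ∷ L) t₂ × TypeC (2 + n) (2 + k) t₂
  ϑ = typeB-ϑ , (proj₁ (second (inj₁ ≤-refl) I) , ϑ-diffs) , proj₂ (second (inj₁ ≤-refl) I)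
    where
    I : Insertion (n ∸ k) (suc n) (2 + n) t₁ (mu (suc n) (suc k) t₁)
    I = insertion (proj₂ typeB-ϑ)
    ϑ-diffs : diffs (mu (suc n) (suc k) t₁) ↭ (2 + k) ∷ (2 + k) ∷ L
    ϑ-diffs = drop-∷ (begin
      (1 + k) ∷ diffs (mu (suc n) (suc k) t₁)
        ↭⟨ insertion-distances I (dist-below 1 k≤n) (dist-below 2 k≤n) (∣n-1+n∣≡1 (suc n)) ⟩
      (2 + k) ∷ 1 ∷ diffs t₁                 ↭⟨ ↭-prep _ η-diffs ⟩
      (2 + k) ∷ (2 + k) ∷ (1 + k) ∷ diffs s  ↭⟨ shift (1 + k) ((2 + k) ∷ (2 + k) ∷ []) (diffs s) ⟩
      (1 + k) ∷ (2 + k) ∷ (2 + k) ∷ diffs s  ↭⟨ ↭-prep _ (↭-prep _ (↭-prep _ (proj₂ real))) ⟩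
      (1 + k) ∷ (2 + k) ∷ (2 + k) ∷ L        ∎)

  σ : let t₂ = mu (suc n) (2 + k) t₁ in
      TypeB (suc n) (2 + k) t₁ × LinReal ((1 + k) ∷ (2 + k + 1) ∷ L) t₂ × TypeC (2 + n) (2 + k) t₂
  σ = typeB-σ , (proj₁ (second out I) , σ-diffs) , proj₂ (second out I)
    where
    out : Outside n k (n ∸ suc k)
    out = inj₁ (∸-monoʳ-≤ n (n≤1+n k))
    I : Insertion (n ∸ suc k) (suc n) (2 + n) t₁ (mu (suc n) (2 + k) t₁)
    I = insertion (proj₂ typeB-σ)
    σ-diffs : diffs (mu (suc n) (2 + k) t₁) ↭ (1 + k) ∷ (2 + k + 1) ∷ L
    σ-diffs = drop-∷ (begin
      (2 + k) ∷ diffs (mu (suc n) (2 + k) t₁)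
        ↭⟨ insertion-distances I (dist-below 1 k<n)
             (trans (dist-below 2 k<n) (cong (2 +_) (+-comm 1 k))) (∣n-1+n∣≡1 (suc n)) ⟩
      (2 + k + 1) ∷ 1 ∷ diffs t₁                 ↭⟨ ↭-prep _ η-diffs ⟩
      (2 + k + 1) ∷ (2 + k) ∷ (1 + k) ∷ diffs s  ↭⟨ ↭-swap _ _ ↭-refl ⟩
      (2 + k) ∷ (2 + k + 1) ∷ (1 + k) ∷ diffs s  ↭⟨ ↭-prep _ (↭-swap _ _ (proj₂ real)) ⟩
      (2 + k) ∷ (1 + k) ∷ (2 + k + 1) ∷ L        ∎)

even-form : ∀ {x} → 2 ∣ x → 2 ≤ x → ∃ λ i → x ≡ 2 + 2 * i
even-form (divides zero    refl) ()
even-form (divides (suc i) refl) _ = i , cong (2 +_) (*-comm i 2)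

proposition2p8 : (L s : List ℕ) (x : ℕ) → 2 ≤ x → 2 ∣ x →
    LinReal L s → TypeC (length L) x s →
    (TypeA (length L) (x ∸ 1) s
      × TypeB (suc (length L)) (x ∸ 1) (eta (length L) (x ∸ 1) s)
      × LinReal (x ∷ x ∷ L) (mu (suc (length L)) (x ∸ 1) (eta (length L) (x ∸ 1) s))
      × TypeC (suc (suc (length L))) x (mu (suc (length L)) (x ∸ 1) (eta (length L) (x ∸ 1) s)))
    ×
    (TypeA (length L) (x ∸ 1) s
      × TypeB (suc (length L)) x (eta (length L) (x ∸ 1) s)
      × LinReal ((x ∸ 1) ∷ (x + 1) ∷ L) (mu (suc (length L)) x (eta (length L) (x ∸ 1) s))
      × TypeC (suc (suc (length L))) x (mu (suc (length L)) x (eta (length L) (x ∸ 1) s)))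
proposition2p8 L s x 2≤x 2∣x real C with even-form 2∣x 2≤x
... | i , refl = (typeA , ϑ) , (typeA , σ)
  where
  typeA : TypeA (length L) (suc (2 * i)) s
  typeA = typeC-last i C
  open TwoInsertions real (typeC-weaken C) typeA
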